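{- For $k\in\mathbb{N}$ let $E(k)=\#\{n\in\mathbb{Z}: 0\le n\le k,\ \chi(n)=0\}$. Then $\lim_{k\to\infty}E(k)/k=1$.
   Context: $f_0=f_1=1$, $f_i=f_{i-1}+f_{i-2}$ ($i\ge2$). The integers $\chi(n)$, $n\in\mathbb{N}$, are defined by $\prod_{i\ge1}(1-x^{f_i})=\sum_{n\ge0}\chi(n)x^n$; equivalently $\chi(n)=\sum_h(-1)^hF_h(n)$, where $F_h(n)$ is the number of ways to write $n$ as a sum of $h$ Fibonacci numbers $f_{i_1}+\dots+f_{i_h}$ with $1\le i_1<\dots<i_h$. -}

module Defs where

open import Data.Nat using (ℕ; zero; suc; _∸_; _≤?_)
import Data.Nat as ℕ
open import Data.Integer using (ℤ; +_; _-_; _≟_)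
open import Data.List using (List; []; _∷_; map; upTo; filter; length)
open import Relation.Nullary using (yes; no)

fib : ℕ → ℕ
fib zero = 1
fib (suc zero) = 1
fib (suc (suc i)) = fib (suc i) ℕ.+ fib i

-- signedSubsets n as = Σ over sub-multisets S (by position) of the list as
-- with Σ S = n of (-1)^|S|
signedSubsets : ℕ → List ℕ → ℤ
signedSubsets zero [] = + 1
signedSubsets (suc _) [] = + 0
signedSubsets n (a ∷ as) with a ≤? n
... | yes _ = signedSubsets n as - signedSubsets (n ∸ a) as
... | no _  = signedSubsets n as

-- indices 1 .. n (f_i ≥ i for i ≥ 1, so indices i > n never contribute)
indices : ℕ → List ℕ
indices n = map suc (upTo n)

-- χ(n) = Σ_h (-1)^h F_h(n), summing over sets of indices 1 ≤ i₁ < … < i_h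
χ : ℕ → ℤ
χ n = signedSubsets n (map fib (indices n))

E : ℕ → ℕ
E k = length (filter (λ n → χ n ≟ + 0) (upTo (suc k)))

-- Write χ⟨ k ⟩ for the coefficients of the truncated product ∏_{i ≤ k} (1 − x^{f_i}). It agrees
-- with χ below f_{k+1}, vanishes from f_{k+2} − 1 on, is palindromic up to the sign (−1)^k, and
-- satisfies χ⟨ k + 4 ⟩ (f_{k+4} + y) = χ⟨ k ⟩ (f_k + y) for y < f_{k+2}. Cutting [f_{j+6}, f_{j+7})
-- into four bands accordingly, the number B_j of nonzero χ(n) with f_{j+1} ≤ n < f_{j+2} satisfies
-- B_{j+5} ≤ 2 N_{j+3} + B_{j+1} + 3, where N_j = 1 + B_0 + ⋯ + B_{j−2} counts the nonzero χ(n)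
-- with n < f_j. Hence B_j = O((8/5)^j), whereas f_j grows like φ^j with φ > 8/5: the nonzero
-- coefficients have density zero, so E(k)/k → 1.
module Submission where

open import Defs

module Sparsity where

  open import Data.Nat using (ℕ; zero; suc; _+_; _*_; _^_; _∸_; _≤_; _≰_; _<_; _≤?_; z≤n; s≤s)
  open import Data.Nat.Properties hiding (_≟_)
  open import Data.Nat.Induction using (<-rec)
  import Data.Nat.Tactic.RingSolver as NS
  open import Data.Integer using (ℤ; +_; -[1+_]; -_; _-_; -1ℤ; 0ℤ; 1ℤ; _≟_) renaming (_*_ to _*ℤ_; _^_ to _^ℤ_)
  import Data.Integer.Properties as ℤ
  open import Data.Integer.Tactic.RingSolver using (solve-∀)
  open import Data.List using ([]; _∷_; _∷ʳ_; map; upTo; applyUpTo; filter; length)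
  open import Data.List.Properties using (map-++; upTo-∷ʳ)
  open import Data.Product using (∃; _×_; _,_; proj₁; proj₂)
  open import Data.Sum using (inj₁; inj₂)
  open import Function using (id; _∘_)
  open import Relation.Binary.PropositionalEquality
  open import Relation.Nullary using (Dec; yes; no; contradiction)

  -- Truncated products

  δ₀ : ℕ → ℤ
  δ₀ zero    = 1ℤ
  δ₀ (suc _) = 0ℤ

  -- shift a F is the coefficient sequence of x^a · F.
  shift : ℕ → (ℕ → ℤ) → ℕ → ℤ
  shift a F m with a ≤? m
  ... | yes _ = F (m ∸ a)
  ... | no  _ = 0ℤ

  mul1-x^ : ℕ → (ℕ → ℤ) → ℕ → ℤ
  mul1-x^ a F m = F m - shift a F m

  module _ (a : ℕ) {F : ℕ → ℤ} {m : ℕ} where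

    shift-≤ : a ≤ m → shift a F m ≡ F (m ∸ a)
    shift-≤ a≤m with a ≤? m
    ... | yes _   = refl
    ... | no  a≰m = contradiction a≤m a≰m

    shift-≰ : a ≰ m → shift a F m ≡ 0ℤ
    shift-≰ a≰m with a ≤? m
    ... | yes a≤m = contradiction a≤m a≰m
    ... | no  _   = refl

  shift-cong : ∀ a {F G : ℕ → ℤ} → (∀ n → F n ≡ G n) → ∀ m → shift a F m ≡ shift a G m
  shift-cong a F≗G m with a ≤? m
  ... | yes _ = F≗G (m ∸ a)
  ... | no  _ = refl

  shift-minus : ∀ a (F G : ℕ → ℤ) m → shift a (λ n → F n - G n) m ≡ shift a F m - shift a G m
  shift-minus a F G m with a ≤? m
  ... | yes _ = refl
  ... | no  _ = refl

  shift-shift : ∀ a b (F : ℕ → ℤ) m → shift b (shift a F) m ≡ shift (a + b) F m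
  shift-shift a b F m with b ≤? m
  ... | no b≰m = sym (shift-≰ (a + b) (b≰m ∘ ≤-trans (m≤n+m b a)))
  ... | yes b≤m with a ≤? m ∸ b
  ...   | yes a≤m∸b = begin
    F (m ∸ b ∸ a)   ≡⟨ cong F (trans (∸-+-assoc m b a) (cong (m ∸_) (+-comm b a))) ⟩
    F (m ∸ (a + b)) ≡⟨ shift-≤ (a + b) (m≤o∸n⇒m+n≤o a b≤m a≤m∸b) ⟨
    shift (a + b) F m ∎
    where open ≡-Reasoning
  ...   | no a≰m∸b = sym (shift-≰ (a + b) (a≰m∸b ∘ m+n≤o⇒m≤o∸n a))

  mul1-x^-cong : ∀ a {F G : ℕ → ℤ} → (∀ n → F n ≡ G n) → ∀ m → mul1-x^ a F m ≡ mul1-x^ a G m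
  mul1-x^-cong a F≗G m = cong₂ _-_ (F≗G m) (shift-cong a F≗G m)

  mul1-x^-comm : ∀ a b (F : ℕ → ℤ) m → mul1-x^ b (mul1-x^ a F) m ≡ mul1-x^ a (mul1-x^ b F) m
  mul1-x^-comm a b F m = begin
    (F m - A) - shift b (λ n → F n - shift a F n) m ≡⟨ cong (_-_ (F m - A)) (shift-minus b F (shift a F) m) ⟩
    (F m - A) - (B - shift b (shift a F) m)         ≡⟨ cong (λ z → (F m - A) - (B - z)) shift-ab≡shift-ba ⟩
    (F m - A) - (B - shift a (shift b F) m)         ≡⟨ exchange (F m) A B _ ⟩
    (F m - B) - (A - shift a (shift b F) m)         ≡⟨ cong (_-_ (F m - B)) (shift-minus a F (shift b F) m) ⟨
    (F m - B) - shift a (λ n → F n - shift b F n) m ∎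
    where
    open ≡-Reasoning
    A = shift a F m
    B = shift b F m
    shift-ab≡shift-ba : shift b (shift a F) m ≡ shift a (shift b F) m
    shift-ab≡shift-ba = trans (shift-shift a b F m)
      (trans (cong (λ c → shift c F m) (+-comm a b)) (sym (shift-shift b a F m)))
    exchange : ∀ (w x y z : ℤ) → (w - x) - (y - z) ≡ (w - y) - (x - z)
    exchange = solve-∀

  mul1-x^-≰ : ∀ a (F : ℕ → ℤ) {m} → a ≰ m → mul1-x^ a F m ≡ F m
  mul1-x^-≰ a F {m} a≰m = trans (cong (_-_ (F m)) (shift-≰ a a≰m)) (ℤ.+-identityʳ (F m))

  mul1-x^-+ : ∀ a (F : ℕ → ℤ) y → mul1-x^ a F (a + y) ≡ F (a + y) - F y
  mul1-x^-+ a F y = cong (_-_ (F (a + y))) (trans (shift-≤ a (m≤m+n a y)) (cong F (m+n∸m≡n a y)))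

  signedSubsets-[] : ∀ m → signedSubsets m [] ≡ δ₀ m
  signedSubsets-[] zero    = refl
  signedSubsets-[] (suc m) = refl

  signedSubsets-∷ : ∀ m a as → signedSubsets m (a ∷ as) ≡ mul1-x^ a (λ n → signedSubsets n as) m
  signedSubsets-∷ zero a as with a ≤? zero
  ... | yes _ = refl
  ... | no  _ = sym (ℤ.+-identityʳ _)
  signedSubsets-∷ (suc m) a as with a ≤? suc m
  ... | yes _ = refl
  ... | no  _ = sym (ℤ.+-identityʳ _)

  signedSubsets-∷ʳ : ∀ m a as → signedSubsets m (as ∷ʳ a) ≡ mul1-x^ a (λ n → signedSubsets n as) m
  signedSubsets-∷ʳ m a []       = signedSubsets-∷ m a []
  signedSubsets-∷ʳ m a (b ∷ as) = begin
    signedSubsets m (b ∷ as ∷ʳ a)                     ≡⟨ signedSubsets-∷ m b (as ∷ʳ a) ⟩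
    mul1-x^ b (λ n → signedSubsets n (as ∷ʳ a)) m     ≡⟨ mul1-x^-cong b (λ n → signedSubsets-∷ʳ n a as) m ⟩
    mul1-x^ b (mul1-x^ a (λ n → signedSubsets n as)) m ≡⟨ mul1-x^-comm a b (λ n → signedSubsets n as) m ⟩
    mul1-x^ a (mul1-x^ b (λ n → signedSubsets n as)) m ≡⟨ mul1-x^-cong a (λ n → signedSubsets-∷ n b as) m ⟨
    mul1-x^ a (λ n → signedSubsets n (b ∷ as)) m      ∎
    where open ≡-Reasoning

  χ⟨_⟩ : ℕ → ℕ → ℤ
  χ⟨ zero ⟩  = δ₀
  χ⟨ suc k ⟩ = mul1-x^ (fib (suc k)) χ⟨ k ⟩

  fib-indices-suc : ∀ k → map fib (indices (suc k)) ≡ map fib (indices k) ∷ʳ fib (suc k)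
  fib-indices-suc k = begin
    map fib (map suc (upTo (suc k)))        ≡⟨ cong (map fib ∘ map suc) (upTo-∷ʳ k) ⟨
    map fib (map suc (upTo k ∷ʳ k))         ≡⟨ cong (map fib) (map-++ suc (upTo k) _) ⟩
    map fib (indices k ∷ʳ suc k)            ≡⟨ map-++ fib (indices k) _ ⟩
    map fib (indices k) ∷ʳ fib (suc k)      ∎
    where open ≡-Reasoning

  χ⟨⟩≡signedSubsets : ∀ k m → χ⟨ k ⟩ m ≡ signedSubsets m (map fib (indices k))
  χ⟨⟩≡signedSubsets zero    m = sym (signedSubsets-[] m)
  χ⟨⟩≡signedSubsets (suc k) m = begin
    mul1-x^ (fib (suc k)) χ⟨ k ⟩ m                                       ≡⟨ mul1-x^-cong (fib (suc k)) (χ⟨⟩≡signedSubsets k) m ⟩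
    mul1-x^ (fib (suc k)) (λ n → signedSubsets n (map fib (indices k))) m ≡⟨ signedSubsets-∷ʳ m (fib (suc k)) _ ⟨
    signedSubsets m (map fib (indices k) ∷ʳ fib (suc k))                  ≡⟨ cong (signedSubsets m) (fib-indices-suc k) ⟨
    signedSubsets m (map fib (indices (suc k)))                           ∎
    where open ≡-Reasoning

  fib-pos : ∀ n → 1 ≤ fib n
  fib-pos zero                = s≤s z≤n
  fib-pos (suc zero)          = s≤s z≤n
  fib-pos (suc (suc n))       = ≤-trans (fib-pos (suc n)) (m≤m+n _ _)

  fib-≤-suc : ∀ n → fib n ≤ fib (suc n)
  fib-≤-suc zero    = ≤-refl
  fib-≤-suc (suc n) = m≤m+n _ _

  fib-mono-≤ : ∀ {i j} → i ≤ j → fib i ≤ fib j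
  fib-mono-≤ {j = zero}  z≤n    = ≤-refl
  fib-mono-≤ {j = suc j} i≤1+j with m≤n⇒m<n∨m≡n i≤1+j
  ... | inj₁ i<1+j = ≤-trans (fib-mono-≤ (≤-pred i<1+j)) (fib-≤-suc j)
  ... | inj₂ refl  = ≤-refl

  fib[1+n]<fib[2+n] : ∀ n → fib (1 + n) < fib (2 + n)
  fib[1+n]<fib[2+n] n = subst (_≤ fib (2 + n)) (+-comm (fib (1 + n)) 1) (+-monoʳ-≤ (fib (1 + n)) (fib-pos n))

  n<fib[1+n] : ∀ n → n < fib (suc n)
  n<fib[1+n] zero    = s≤s z≤n
  n<fib[1+n] (suc n) = ≤-trans (s≤s (n<fib[1+n] n)) (fib[1+n]<fib[2+n] n)

  χ⟨suc⟩-< : ∀ k {y} → y < fib (suc k) → χ⟨ suc k ⟩ y ≡ χ⟨ k ⟩ y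
  χ⟨suc⟩-< k y<f = mul1-x^-≰ (fib (suc k)) χ⟨ k ⟩ (<⇒≱ y<f)

  χ⟨suc⟩-+ : ∀ k y → χ⟨ suc k ⟩ (fib (suc k) + y) ≡ χ⟨ k ⟩ (fib (suc k) + y) - χ⟨ k ⟩ y
  χ⟨suc⟩-+ k = mul1-x^-+ (fib (suc k)) χ⟨ k ⟩

  χ⟨⟩-stable : ∀ {k l y} → k ≤ l → y < fib (suc k) → χ⟨ l ⟩ y ≡ χ⟨ k ⟩ y
  χ⟨⟩-stable {l = zero}  z≤n   _   = refl
  χ⟨⟩-stable {l = suc l} k≤1+l y<f with m≤n⇒m<n∨m≡n k≤1+l
  ... | inj₁ k<1+l = trans (χ⟨suc⟩-< l (≤-trans y<f (fib-mono-≤ k<1+l))) (χ⟨⟩-stable (≤-pred k<1+l) y<f)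
  ... | inj₂ refl  = refl

  χ≡χ⟨⟩ : ∀ k {y} → y < fib (suc k) → χ y ≡ χ⟨ k ⟩ y
  χ≡χ⟨⟩ k {y} y<f with ≤-total k y
  ... | inj₁ k≤y = trans (sym (χ⟨⟩≡signedSubsets y y)) (χ⟨⟩-stable k≤y y<f)
  ... | inj₂ y≤k = trans (sym (χ⟨⟩≡signedSubsets y y)) (sym (χ⟨⟩-stable y≤k (n<fib[1+n] y)))

  -- The product ∏_{i=1}^{k} (1 − x^{f_i}) has degree f_1 + ⋯ + f_k = f_{k+2} − 2.
  χ⟨⟩-vanishes : ∀ k y → fib (2 + k) ≤ y + 1 → χ⟨ k ⟩ y ≡ 0ℤ
  χ⟨⟩-vanishes zero    zero    (s≤s ())
  χ⟨⟩-vanishes zero    (suc y) _ = refl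
  χ⟨⟩-vanishes (suc k) y f≤y+1 = vanishes-at (m≤n⇒∃[o]m+o≡n F≤y)
    where
    F = fib (suc k)
    F≤y : F ≤ y
    F≤y = +-cancelʳ-≤ 1 F y (begin
      F + 1               ≤⟨ +-monoʳ-≤ F (fib-pos (2 + k)) ⟩
      F + fib (2 + k)     ≡⟨ +-comm F _ ⟩
      fib (3 + k)         ≤⟨ f≤y+1 ⟩
      y + 1               ∎)
      where open ≤-Reasoning
    vanishes-at : ∃ (λ y' → F + y' ≡ y) → χ⟨ suc k ⟩ y ≡ 0ℤ
    vanishes-at (y' , refl) = begin
      χ⟨ suc k ⟩ (F + y')             ≡⟨ χ⟨suc⟩-+ k y' ⟩
      χ⟨ k ⟩ (F + y') - χ⟨ k ⟩ y'     ≡⟨ cong₂ _-_ (χ⟨⟩-vanishes k (F + y') (≤-trans (m≤m+n _ F) f≤y+1))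
                                                    (χ⟨⟩-vanishes k y' f≤y'+1) ⟩
      0ℤ                              ∎
      where
      open ≡-Reasoning
      f≤y'+1 : fib (2 + k) ≤ y' + 1
      f≤y'+1 = +-cancelˡ-≤ F _ _ (subst₂ _≤_ (+-comm (fib (2 + k)) F) (+-assoc F y' 1) f≤y+1)

  [F+a]+b+2≡[a+b+2]+F : ∀ F a b → (F + a) + b + 2 ≡ (a + b + 2) + F
  [F+a]+b+2≡[a+b+2]+F = NS.solve-∀

  a+[F+b]+2≡[a+b+2]+F : ∀ F a b → a + (F + b) + 2 ≡ (a + b + 2) + F
  a+[F+b]+2≡[a+b+2]+F = NS.solve-∀

  [F+a]+b+2≡G+F⇒a+b+2≡G : ∀ F a b {G} → (F + a) + b + 2 ≡ G + F → a + b + 2 ≡ G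
  [F+a]+b+2≡G+F⇒a+b+2≡G F a b {G} e = +-cancelʳ-≡ F _ G (trans (sym ([F+a]+b+2≡[a+b+2]+F F a b)) e)

  a+[F+b]+2≡G+F⇒a+b+2≡G : ∀ F a b {G} → a + (F + b) + 2 ≡ G + F → a + b + 2 ≡ G
  a+[F+b]+2≡G+F⇒a+b+2≡G F a b {G} e = +-cancelʳ-≡ F _ G (trans (sym (a+[F+b]+2≡[a+b+2]+F F a b)) e)

  a+b+2≡c⇒a<c : ∀ {a b c} → a + b + 2 ≡ c → a < c
  a+b+2≡c⇒a<c {a} {b} e = subst (a <_) e (<-≤-trans (m<m+n a (s≤s z≤n)) (+-monoˡ-≤ 2 (m≤m+n a b)))

  a+b+2≡c⇒b<c : ∀ {a b c} → a + b + 2 ≡ c → b < c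
  a+b+2≡c⇒b<c {a} {b} e = subst (b <_) e (<-≤-trans (m<m+n b (s≤s z≤n)) (+-monoˡ-≤ 2 (m≤n+m b a)))

  a+b≤a+[b+c]+1 : ∀ a b c → a + b ≤ a + (b + c) + 1
  a+b≤a+[b+c]+1 a b c = subst (a + b ≤_) (sym (+-assoc a (b + c) 1)) (+-monoʳ-≤ a (≤-trans (m≤m+n b c) (m≤m+n (b + c) 1)))

  a<F⇒a+b+2≤F+b+1 : ∀ {a F} b → a < F → a + b + 2 ≤ F + b + 1
  a<F⇒a+b+2≤F+b+1 {a} {F} b a<F = subst (_≤ F + b + 1) (sym (+-suc (a + b) 1)) (+-monoˡ-≤ 1 (+-monoˡ-≤ b a<F))

  -- x^{f_{k+2} − 2} · ∏_{i ≤ k} (1 − x^{−f_i}) = (−1)^k · ∏_{i ≤ k} (1 − x^{f_i}).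
  χ⟨⟩-palindrome : ∀ k x y → x + y + 2 ≡ fib (2 + k) → χ⟨ k ⟩ y ≡ -1ℤ ^ℤ k *ℤ χ⟨ k ⟩ x
  χ⟨⟩-palindrome zero x y e with +-cancelʳ-≡ 2 (x + y) 0 e
  ... | x+y≡0 with m+n≡0⇒m≡0 x x+y≡0 | m+n≡0⇒n≡0 x x+y≡0
  ...   | refl | refl = refl
  χ⟨⟩-palindrome (suc k) x y e = go (F ≤? y) (F ≤? x)
    where
    open ≡-Reasoning
    F = fib (suc k)
    s = -1ℤ ^ℤ k
    go : Dec (F ≤ y) → Dec (F ≤ x) → χ⟨ suc k ⟩ y ≡ -1ℤ *ℤ s *ℤ χ⟨ suc k ⟩ x
    go (yes F≤y) (yes F≤x) with m≤n⇒∃[o]m+o≡n F≤y | m≤n⇒∃[o]m+o≡n F≤x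
    ... | y' , refl | x' , refl = begin
      χ⟨ suc k ⟩ (F + y')                    ≡⟨ χ⟨suc⟩-+ k y' ⟩
      χ⟨ k ⟩ (F + y') - χ⟨ k ⟩ y'            ≡⟨ cong₂ _-_ (χ⟨⟩-palindrome k x' (F + y') ([F+a]+b+2≡G+F⇒a+b+2≡G F x' (F + y') e))
                                                          (χ⟨⟩-palindrome k (F + x') y' (a+[F+b]+2≡G+F⇒a+b+2≡G F (F + x') y' e)) ⟩
      s *ℤ χ⟨ k ⟩ x' - s *ℤ χ⟨ k ⟩ (F + x')  ≡⟨ factor s _ _ ⟩
      -1ℤ *ℤ s *ℤ (χ⟨ k ⟩ (F + x') - χ⟨ k ⟩ x') ≡⟨ cong (-1ℤ *ℤ s *ℤ_) (χ⟨suc⟩-+ k x') ⟨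
      -1ℤ *ℤ s *ℤ χ⟨ suc k ⟩ (F + x')        ∎
      where
      factor : ∀ s a b → s *ℤ a - s *ℤ b ≡ -1ℤ *ℤ s *ℤ (b - a)
      factor = solve-∀
    go (yes F≤y) (no F≰x) with m≤n⇒∃[o]m+o≡n F≤y
    ... | y' , refl = begin
      χ⟨ suc k ⟩ (F + y')                    ≡⟨ χ⟨suc⟩-+ k y' ⟩
      χ⟨ k ⟩ (F + y') - χ⟨ k ⟩ y'            ≡⟨ cong₂ _-_ (χ⟨⟩-vanishes k (F + y') y-outside) (χ⟨⟩-palindrome k x y' e') ⟩
      0ℤ - s *ℤ χ⟨ k ⟩ x                     ≡⟨ factor s _ ⟩
      -1ℤ *ℤ s *ℤ χ⟨ k ⟩ x                   ≡⟨ cong (-1ℤ *ℤ s *ℤ_) (χ⟨suc⟩-< k (≰⇒> F≰x)) ⟨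
      -1ℤ *ℤ s *ℤ χ⟨ suc k ⟩ x               ∎
      where
      e' = a+[F+b]+2≡G+F⇒a+b+2≡G F x y' e
      y-outside : fib (2 + k) ≤ F + y' + 1
      y-outside = subst (_≤ F + y' + 1) e' (a<F⇒a+b+2≤F+b+1 y' (≰⇒> F≰x))
      factor : ∀ s a → 0ℤ - s *ℤ a ≡ -1ℤ *ℤ s *ℤ a
      factor = solve-∀
    go (no F≰y) (yes F≤x) with m≤n⇒∃[o]m+o≡n F≤x
    ... | x' , refl = begin
      χ⟨ suc k ⟩ y                           ≡⟨ χ⟨suc⟩-< k (≰⇒> F≰y) ⟩
      χ⟨ k ⟩ y                               ≡⟨ χ⟨⟩-palindrome k x' y e' ⟩
      s *ℤ χ⟨ k ⟩ x'                         ≡⟨ factor s _ ⟩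
      -1ℤ *ℤ s *ℤ (0ℤ - χ⟨ k ⟩ x')           ≡⟨ cong (λ z → -1ℤ *ℤ s *ℤ (z - χ⟨ k ⟩ x')) (χ⟨⟩-vanishes k (F + x') x-outside) ⟨
      -1ℤ *ℤ s *ℤ (χ⟨ k ⟩ (F + x') - χ⟨ k ⟩ x') ≡⟨ cong (-1ℤ *ℤ s *ℤ_) (χ⟨suc⟩-+ k x') ⟨
      -1ℤ *ℤ s *ℤ χ⟨ suc k ⟩ (F + x')        ∎
      where
      e' = [F+a]+b+2≡G+F⇒a+b+2≡G F x' y e
      x-outside : fib (2 + k) ≤ F + x' + 1
      x-outside = subst (_≤ F + x' + 1) (trans (cong (_+ 2) (+-comm y x')) e') (a<F⇒a+b+2≤F+b+1 x' (≰⇒> F≰y))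
      factor : ∀ s a → s *ℤ a ≡ -1ℤ *ℤ s *ℤ (0ℤ - a)
      factor = solve-∀
    go (no F≰y) (no F≰x) = contradiction (subst (_≤ F + F) e x+y+2≤F+F) (<⇒≱ F+F<G+F)
      where
      suc-+-suc : ∀ x y → suc x + suc y ≡ x + y + 2
      suc-+-suc = NS.solve-∀
      x+y+2≤F+F : x + y + 2 ≤ F + F
      x+y+2≤F+F = subst (_≤ F + F) (suc-+-suc x y) (+-mono-≤ (≰⇒> F≰x) (≰⇒> F≰y))
      F+F<G+F : F + F < fib (2 + k) + F
      F+F<G+F = +-monoˡ-< F (fib[1+n]<fib[2+n] k)

  χ⟨2+⟩-+ : ∀ k y → χ⟨ 2 + k ⟩ (fib (2 + k) + y) ≡ - χ⟨ 1 + k ⟩ y - χ⟨ k ⟩ (fib k + y)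
  χ⟨2+⟩-+ k y = begin
    χ⟨ 2 + k ⟩ (fib (2 + k) + y)                               ≡⟨ χ⟨suc⟩-+ (1 + k) y ⟩
    χ⟨ 1 + k ⟩ (fib (2 + k) + y) - χ⟨ 1 + k ⟩ y                ≡⟨ cong (λ z → χ⟨ 1 + k ⟩ z - χ⟨ 1 + k ⟩ y) (+-assoc F (fib k) y) ⟩
    χ⟨ 1 + k ⟩ (F + (fib k + y)) - χ⟨ 1 + k ⟩ y                ≡⟨ cong (_- χ⟨ 1 + k ⟩ y) (χ⟨suc⟩-+ k (fib k + y)) ⟩
    (χ⟨ k ⟩ (F + (fib k + y)) - χ⟨ k ⟩ (fib k + y)) - χ⟨ 1 + k ⟩ y
      ≡⟨ cong (λ z → (z - χ⟨ k ⟩ (fib k + y)) - χ⟨ 1 + k ⟩ y) (χ⟨⟩-vanishes k _ outside) ⟩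
    (0ℤ - χ⟨ k ⟩ (fib k + y)) - χ⟨ 1 + k ⟩ y                   ≡⟨ rearrange (χ⟨ k ⟩ (fib k + y)) (χ⟨ 1 + k ⟩ y) ⟩
    - χ⟨ 1 + k ⟩ y - χ⟨ k ⟩ (fib k + y)                        ∎
    where
    open ≡-Reasoning
    F = fib (1 + k)
    outside : fib (2 + k) ≤ F + (fib k + y) + 1
    outside = a+b≤a+[b+c]+1 F (fib k) y
    rearrange : ∀ a b → (0ℤ - a) - b ≡ - b - a
    rearrange = solve-∀

  χ⟨4+⟩-+ : ∀ k {y} → y < fib (2 + k) → χ⟨ 4 + k ⟩ (fib (4 + k) + y) ≡ χ⟨ k ⟩ (fib k + y)
  χ⟨4+⟩-+ k {y} y<f = begin
    χ⟨ 4 + k ⟩ (fib (4 + k) + y)                            ≡⟨ χ⟨2+⟩-+ (2 + k) y ⟩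
    - χ⟨ 3 + k ⟩ y - χ⟨ 2 + k ⟩ (fib (2 + k) + y)           ≡⟨ cong₂ (λ u v → - u - v) (χ⟨⟩-stable (m≤n+m (1 + k) 2) y<f) (χ⟨2+⟩-+ k y) ⟩
    - χ⟨ 1 + k ⟩ y - (- χ⟨ 1 + k ⟩ y - χ⟨ k ⟩ (fib k + y)) ≡⟨ cancel (χ⟨ 1 + k ⟩ y) (χ⟨ k ⟩ (fib k + y)) ⟩
    χ⟨ k ⟩ (fib k + y)                                      ∎
    where
    open ≡-Reasoning
    cancel : ∀ a b → - a - (- a - b) ≡ b
    cancel = solve-∀

  -- Counting nonzero coefficients

  isNonzero : ℤ → ℕ
  isNonzero (+ zero)  = 0
  isNonzero (+ suc _) = 1
  isNonzero -[1+ _ ]  = 1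

  isNonzero≤1 : ∀ z → isNonzero z ≤ 1
  isNonzero≤1 (+ zero)  = z≤n
  isNonzero≤1 (+ suc _) = ≤-refl
  isNonzero≤1 -[1+ _ ]  = ≤-refl

  isNonzero-≢0 : ∀ {z} → z ≢ 0ℤ → isNonzero z ≡ 1
  isNonzero-≢0 {+ zero}  z≢0 = contradiction refl z≢0
  isNonzero-≢0 {+ suc _} _   = refl
  isNonzero-≢0 { -[1+ _ ]} _  = refl

  isNonzero-neg : ∀ z → isNonzero (- z) ≡ isNonzero z
  isNonzero-neg (+ zero)  = refl
  isNonzero-neg (+ suc _) = refl
  isNonzero-neg -[1+ _ ]  = refl

  isNonzero-± : ∀ k z → isNonzero (-1ℤ ^ℤ k *ℤ z) ≡ isNonzero z
  isNonzero-± zero    z = cong isNonzero (ℤ.*-identityˡ z)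
  isNonzero-± (suc k) z = begin
    isNonzero (-1ℤ *ℤ -1ℤ ^ℤ k *ℤ z)  ≡⟨ cong isNonzero (neg-assoc (-1ℤ ^ℤ k) z) ⟩
    isNonzero (- (-1ℤ ^ℤ k *ℤ z))     ≡⟨ isNonzero-neg _ ⟩
    isNonzero (-1ℤ ^ℤ k *ℤ z)         ≡⟨ isNonzero-± k z ⟩
    isNonzero z                       ∎
    where
    open ≡-Reasoning
    neg-assoc : ∀ s z → -1ℤ *ℤ s *ℤ z ≡ - (s *ℤ z)
    neg-assoc = solve-∀

  isNonzero-minus : ∀ a b → isNonzero (a - b) ≤ isNonzero a + isNonzero b
  isNonzero-minus (+ zero)  b = ≤-reflexive (trans (cong isNonzero (ℤ.+-identityˡ (- b))) (isNonzero-neg b))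
  isNonzero-minus (+ suc n) b = ≤-trans (isNonzero≤1 _) (m≤m+n 1 (isNonzero b))
  isNonzero-minus -[1+ n ]  b = ≤-trans (isNonzero≤1 _) (m≤m+n 1 (isNonzero b))

  χ⟨⟩-mirror : ∀ k {x y} → x + y + 2 ≡ fib (2 + k) → x < fib (1 + k) → isNonzero (χ⟨ k ⟩ y) ≡ isNonzero (χ x)
  χ⟨⟩-mirror k {x} {y} e x<f = begin
    isNonzero (χ⟨ k ⟩ y)              ≡⟨ cong isNonzero (χ⟨⟩-palindrome k x y e) ⟩
    isNonzero (-1ℤ ^ℤ k *ℤ χ⟨ k ⟩ x)  ≡⟨ isNonzero-± k _ ⟩
    isNonzero (χ⟨ k ⟩ x)              ≡⟨ cong isNonzero (χ≡χ⟨⟩ k x<f) ⟨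
    isNonzero (χ x)                   ∎
    where open ≡-Reasoning

  ∑ : (ℕ → ℕ) → ℕ → ℕ
  ∑ u zero    = 0
  ∑ u (suc n) = u 0 + ∑ (u ∘ suc) n

  ∑-+ : ∀ u n m → ∑ u (n + m) ≡ ∑ u n + ∑ (λ i → u (n + i)) m
  ∑-+ u zero    m = refl
  ∑-+ u (suc n) m = trans (cong (_+_ (u 0)) (∑-+ (u ∘ suc) n m)) (sym (+-assoc (u 0) _ _))

  ∑-suc : ∀ u n → ∑ u (suc n) ≡ ∑ u n + u n
  ∑-suc u n = begin
    ∑ u (suc n)                       ≡⟨ cong (∑ u) (+-comm 1 n) ⟩
    ∑ u (n + 1)                       ≡⟨ ∑-+ u n 1 ⟩
    ∑ u n + (u (n + 0) + 0)           ≡⟨ cong (λ z → ∑ u n + z) (trans (+-identityʳ _) (cong u (+-identityʳ n))) ⟩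
    ∑ u n + u n                       ∎
    where open ≡-Reasoning

  ∑-mono-≤ : ∀ {u v} n → (∀ i → i < n → u i ≤ v i) → ∑ u n ≤ ∑ v n
  ∑-mono-≤ zero    u≤v = z≤n
  ∑-mono-≤ (suc n) u≤v = +-mono-≤ (u≤v 0 (s≤s z≤n)) (∑-mono-≤ n (λ i i<n → u≤v (suc i) (s≤s i<n)))

  ∑-cong : ∀ {u v} n → (∀ i → i < n → u i ≡ v i) → ∑ u n ≡ ∑ v n
  ∑-cong zero    u≡v = refl
  ∑-cong (suc n) u≡v = cong₂ _+_ (u≡v 0 (s≤s z≤n)) (∑-cong n (λ i i<n → u≡v (suc i) (s≤s i<n)))

  ∑-zero : ∀ {u} n → (∀ i → i < n → u i ≡ 0) → ∑ u n ≡ 0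
  ∑-zero zero    u≡0 = refl
  ∑-zero (suc n) u≡0 = cong₂ _+_ (u≡0 0 (s≤s z≤n)) (∑-zero n (λ i i<n → u≡0 (suc i) (s≤s i<n)))

  ∑-distrib-+ : ∀ u v n → ∑ (λ i → u i + v i) n ≡ ∑ u n + ∑ v n
  ∑-distrib-+ u v zero    = refl
  ∑-distrib-+ u v (suc n) = trans (cong (_+_ (u 0 + v 0)) (∑-distrib-+ (u ∘ suc) (v ∘ suc) n)) (swap (u 0) (v 0) _ _)
    where
    swap : ∀ a b c d → a + b + (c + d) ≡ a + c + (b + d)
    swap = NS.solve-∀

  ∑-≤-length : ∀ {u} n → (∀ i → u i ≤ 1) → ∑ u n ≤ n
  ∑-≤-length zero    u≤1 = z≤n
  ∑-≤-length (suc n) u≤1 = +-mono-≤ (u≤1 0) (∑-≤-length n (u≤1 ∘ suc))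

  ∑-mono-≤-length : ∀ u {n m} → n ≤ m → ∑ u n ≤ ∑ u m
  ∑-mono-≤-length u {n} n≤m with m≤n⇒∃[o]m+o≡n n≤m
  ... | o , refl = subst (∑ u n ≤_) (sym (∑-+ u n o)) (m≤m+n _ _)

  ∑-reverse-≤ : ∀ {u v} n → (∀ i j → j + i + 1 ≡ n → u i ≤ v j) → ∑ u n ≤ ∑ v n
  ∑-reverse-≤         zero    _   = z≤n
  ∑-reverse-≤ {u} {v} (suc n) u≤v = begin
    u 0 + ∑ (u ∘ suc) n  ≤⟨ +-mono-≤ (u≤v 0 n (trans (cong (_+ 1) (+-identityʳ n)) (+-comm n 1)))
                                     (∑-reverse-≤ n (λ i j e → u≤v (suc i) j (trans (cong (_+ 1) (+-suc j i)) (cong suc e)))) ⟩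
    v n + ∑ v n          ≡⟨ +-comm (v n) _ ⟩
    ∑ v n + v n          ≡⟨ ∑-suc v n ⟨
    ∑ v (suc n)          ∎
    where open ≤-Reasoning

  ∑-mirror-≤ : ∀ {u v} n → (∀ i j → j + i + 2 ≡ n → u i ≤ v j) → (∀ i → u i ≤ 1) → ∑ u n ≤ 1 + ∑ v n
  ∑-mirror-≤ {u} {v} n u≤v u≤1 = ≤-trans (∑-reverse-≤ n u≤v') (1+∑ n)
    where
    1∷v : ℕ → ℕ
    1∷v zero    = 1
    1∷v (suc j) = v j
    u≤v' : ∀ i j → j + i + 1 ≡ n → u i ≤ 1∷v j
    u≤v' i zero    _ = u≤1 i
    u≤v' i (suc j) e = u≤v i j (trans (+-suc (j + i) 1) e)
    1+∑ : ∀ n → ∑ 1∷v n ≤ 1 + ∑ v n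
    1+∑ zero    = z≤n
    1+∑ (suc n) = +-monoʳ-≤ 1 (∑-mono-≤-length v (n≤1+n n))

  nonzeros : ℕ → ℕ → ℕ
  nonzeros a = ∑ (λ i → isNonzero (χ (a + i)))

  N : ℕ → ℕ
  N j = nonzeros 0 (fib j)

  B : ℕ → ℕ
  B j = nonzeros (fib (1 + j)) (fib j)

  -- With f i = f_{i+t}, the window [f 6, f 7) counted by B (5 + t) is cut, relative to f 6, into
  -- [0, f 3), where χ is ± the mirror image of χ on [0, f 3); [f 3, f 4), where χ vanishes;
  -- [f 4, f 4 + f 2), where χ is a combination of two mirrored pieces; and [f 4 + f 2, f 5), where
  -- χ repeats χ on [f 2, f 3).
  module Block (t : ℕ) where

    f : ℕ → ℕ
    f i = fib (i + t)

    u low high : ℕ → ℕ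
    u m    = isNonzero (χ (f 6 + m))
    low r  = isNonzero (χ⟨ t ⟩ (f 0 + r))
    high r = isNonzero (χ⟨ 4 + t ⟩ (f 4 + (f 4 + r)))

    f-≤-suc : ∀ i → f i ≤ f (suc i)
    f-≤-suc i = fib-≤-suc (i + t)

    χ≡χ⟨6⟩ : ∀ {m} → m < f 5 → χ (f 6 + m) ≡ χ⟨ 6 + t ⟩ (f 6 + m)
    χ≡χ⟨6⟩ m<f5 = χ≡χ⟨⟩ (6 + t) (+-monoʳ-< (f 6) m<f5)

    mirror-band : ∀ {m x} → x + m + 2 ≡ f 3 → u m ≡ isNonzero (χ x)
    mirror-band {m} {x} e = begin
      isNonzero (χ (f 6 + m))          ≡⟨ cong isNonzero (χ≡χ⟨6⟩ (≤-trans m<f3 (≤-trans (f-≤-suc 3) (f-≤-suc 4)))) ⟩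
      isNonzero (χ⟨ 6 + t ⟩ (f 6 + m)) ≡⟨ cong isNonzero (χ⟨4+⟩-+ (2 + t) (≤-trans m<f3 (f-≤-suc 3))) ⟩
      isNonzero (χ⟨ 2 + t ⟩ (f 2 + m)) ≡⟨ χ⟨⟩-mirror (2 + t) {x} (trans (a+[F+b]+2≡[a+b+2]+F (f 2) x m) (cong (_+ f 2) e))
                                                                (a+b+2≡c⇒a<c {x} e) ⟩
      isNonzero (χ x)                  ∎
      where
      open ≡-Reasoning
      m<f3 = a+b+2≡c⇒b<c e

    zero-band : ∀ {r} → r < f 2 → χ (f 6 + (f 3 + r)) ≡ 0ℤ
    zero-band {r} r<f2 = begin
      χ (f 6 + Y)                                                 ≡⟨ χ≡χ⟨6⟩ (≤-trans Y<f4 (f-≤-suc 4)) ⟩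
      χ⟨ 6 + t ⟩ (f 6 + Y)                                        ≡⟨ χ⟨2+⟩-+ (4 + t) Y ⟩
      - χ⟨ 5 + t ⟩ Y - χ⟨ 4 + t ⟩ (f 4 + Y)                       ≡⟨ cong₂ (λ u v → - u - v) (χ⟨⟩-stable (m≤n+m (3 + t) 2) Y<f4)
                                                                                              (χ⟨suc⟩-+ (3 + t) Y) ⟩
      - χ⟨ 3 + t ⟩ Y - (χ⟨ 3 + t ⟩ (f 4 + Y) - χ⟨ 3 + t ⟩ Y)      ≡⟨ cong (λ z → - χ⟨ 3 + t ⟩ Y - (z - χ⟨ 3 + t ⟩ Y))
                                                                          (χ⟨⟩-vanishes (3 + t) (f 4 + Y) (a+b≤a+[b+c]+1 (f 4) (f 3) r)) ⟩
      - χ⟨ 3 + t ⟩ Y - (0ℤ - χ⟨ 3 + t ⟩ Y)                        ≡⟨ cancel (χ⟨ 3 + t ⟩ Y) ⟩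
      0ℤ                                                          ∎
      where
      open ≡-Reasoning
      Y = f 3 + r
      Y<f4 : Y < f 4
      Y<f4 = +-monoʳ-< (f 3) r<f2
      cancel : ∀ a → - a - (0ℤ - a) ≡ 0ℤ
      cancel = solve-∀

    split-band : ∀ {r} → r < f 2 → u (f 4 + r) ≤ low r + high r
    split-band {r} r<f2 = begin
      isNonzero (χ (f 6 + Y))                                   ≡⟨ cong isNonzero (trans (χ≡χ⟨6⟩ Y<f5) (χ⟨2+⟩-+ (4 + t) Y)) ⟩
      isNonzero (- χ⟨ 5 + t ⟩ Y - χ⟨ 4 + t ⟩ (f 4 + Y))         ≤⟨ isNonzero-minus (- χ⟨ 5 + t ⟩ Y) _ ⟩
      isNonzero (- χ⟨ 5 + t ⟩ Y) + isNonzero (χ⟨ 4 + t ⟩ (f 4 + Y))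
        ≡⟨ cong (_+ isNonzero (χ⟨ 4 + t ⟩ (f 4 + Y))) (trans (isNonzero-neg _) (cong isNonzero χ⟨5+t⟩Y≡χ⟨t⟩)) ⟩
      isNonzero (χ⟨ t ⟩ (f 0 + r)) + isNonzero (χ⟨ 4 + t ⟩ (f 4 + Y)) ∎
      where
      open ≤-Reasoning
      Y = f 4 + r
      Y<f5 : Y < f 5
      Y<f5 = +-monoʳ-< (f 4) (≤-trans r<f2 (f-≤-suc 2))
      χ⟨5+t⟩Y≡χ⟨t⟩ : χ⟨ 5 + t ⟩ Y ≡ χ⟨ t ⟩ (f 0 + r)
      χ⟨5+t⟩Y≡χ⟨t⟩ = trans (χ⟨suc⟩-< (4 + t) Y<f5) (χ⟨4+⟩-+ t r<f2)

    repeat-band : ∀ {s} → s < f 1 → χ (f 6 + (f 4 + (f 2 + s))) ≡ χ (f 2 + s)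
    repeat-band {s} s<f1 = begin
      χ (f 6 + Y)                                         ≡⟨ trans (χ≡χ⟨6⟩ Y<f5) (χ⟨2+⟩-+ (4 + t) Y) ⟩
      - χ⟨ 5 + t ⟩ Y - χ⟨ 4 + t ⟩ (f 4 + Y)               ≡⟨ cong₂ (λ u v → - u - v) χ⟨5+t⟩Y χ⟨4+t⟩[f4+Y] ⟩
      - (- χ Y' - W) - (0ℤ - (0ℤ - W))                    ≡⟨ cancel (χ Y') W ⟩
      χ Y'                                                ∎
      where
      open ≡-Reasoning
      Y' = f 2 + s
      Y = f 4 + Y'
      W = χ⟨ 2 + t ⟩ (f 2 + Y')
      Y'<f3 : Y' < f 3
      Y'<f3 = +-monoʳ-< (f 2) s<f1
      Y<f5 : Y < f 5
      Y<f5 = +-monoʳ-< (f 4) Y'<f3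
      χ⟨5+t⟩Y : χ⟨ 5 + t ⟩ Y ≡ - χ Y' - W
      χ⟨5+t⟩Y = begin
        χ⟨ 5 + t ⟩ Y                              ≡⟨ χ⟨suc⟩-< (4 + t) Y<f5 ⟩
        χ⟨ 4 + t ⟩ Y                              ≡⟨ χ⟨2+⟩-+ (2 + t) Y' ⟩
        - χ⟨ 3 + t ⟩ Y' - W                       ≡⟨ cong (λ z → - z - W) (χ≡χ⟨⟩ (3 + t) (≤-trans Y'<f3 (f-≤-suc 3))) ⟨
        - χ Y' - W                                ∎
      χ⟨3+t⟩[f4+Y'] : χ⟨ 3 + t ⟩ (f 4 + Y') ≡ 0ℤ - W
      χ⟨3+t⟩[f4+Y'] = begin
        χ⟨ 3 + t ⟩ (f 4 + Y')                     ≡⟨ cong χ⟨ 3 + t ⟩ (+-assoc (f 3) (f 2) Y') ⟩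
        χ⟨ 3 + t ⟩ (f 3 + (f 2 + Y'))             ≡⟨ χ⟨suc⟩-+ (2 + t) (f 2 + Y') ⟩
        χ⟨ 2 + t ⟩ (f 3 + (f 2 + Y')) - W         ≡⟨ cong (_- W) (χ⟨⟩-vanishes (2 + t) _ (a+b≤a+[b+c]+1 (f 3) (f 2) Y')) ⟩
        0ℤ - W                                    ∎
      χ⟨4+t⟩[f4+Y] : χ⟨ 4 + t ⟩ (f 4 + Y) ≡ 0ℤ - (0ℤ - W)
      χ⟨4+t⟩[f4+Y] = begin
        χ⟨ 4 + t ⟩ (f 4 + Y)                                  ≡⟨ χ⟨suc⟩-+ (3 + t) Y ⟩
        χ⟨ 3 + t ⟩ (f 4 + Y) - χ⟨ 3 + t ⟩ (f 4 + Y')          ≡⟨ cong₂ _-_ (χ⟨⟩-vanishes (3 + t) (f 4 + Y) outside) χ⟨3+t⟩[f4+Y'] ⟩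
        0ℤ - (0ℤ - W)                                         ∎
        where
        outside : f 5 ≤ f 4 + Y + 1
        outside = ≤-trans (+-monoʳ-≤ (f 4) (f-≤-suc 3)) (a+b≤a+[b+c]+1 (f 4) (f 4) Y')
      cancel : ∀ a w → - (- a - w) - (0ℤ - (0ℤ - w)) ≡ a
      cancel = solve-∀

    ∑-mirror-band : ∑ u (f 3) ≤ 1 + N (3 + t)
    ∑-mirror-band = ∑-mirror-≤ (f 3) (λ i j e → ≤-reflexive (mirror-band e)) (λ _ → isNonzero≤1 _)

    ∑-zero-band : ∑ (λ i → u (f 3 + i)) (f 2) ≡ 0
    ∑-zero-band = ∑-zero (f 2) (λ i i<f2 → cong isNonzero (zero-band i<f2))

    ∑-low : ∑ low (f 2) ≤ 1 + N (1 + t)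
    ∑-low = begin
      ∑ low (f 1 + f 0)                           ≡⟨ ∑-+ low (f 1) (f 0) ⟩
      ∑ low (f 1) + ∑ (λ i → low (f 1 + i)) (f 0) ≡⟨ cong (_+_ (∑ low (f 1))) tail-vanishes ⟩
      ∑ low (f 1) + 0                             ≡⟨ +-identityʳ _ ⟩
      ∑ low (f 1)                                 ≤⟨ ∑-mirror-≤ (f 1) head-mirror (λ _ → isNonzero≤1 _) ⟩
      1 + N (1 + t)                               ∎
      where
      open ≤-Reasoning
      outside : ∀ i → f 2 ≤ f 0 + (f 1 + i) + 1
      outside i = subst (_≤ f 0 + (f 1 + i) + 1) (+-comm (f 0) (f 1)) (a+b≤a+[b+c]+1 (f 0) (f 1) i)
      tail-vanishes : ∑ (λ i → low (f 1 + i)) (f 0) ≡ 0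
      tail-vanishes = ∑-zero (f 0) (λ i _ → cong isNonzero (χ⟨⟩-vanishes t (f 0 + (f 1 + i)) (outside i)))
      mirrored : ∀ i j → j + i + 2 ≡ f 1 → j + (f 0 + i) + 2 ≡ f 2
      mirrored i j e = trans (a+[F+b]+2≡[a+b+2]+F (f 0) j i) (cong (_+ f 0) e)
      head-mirror : ∀ i j → j + i + 2 ≡ f 1 → low i ≤ isNonzero (χ j)
      head-mirror i j e = ≤-reflexive (χ⟨⟩-mirror t (mirrored i j e) (a+b+2≡c⇒a<c {j} e))

    ∑-high : ∑ high (f 2) ≤ 1 + nonzeros (f 1) (f 2)
    ∑-high = ∑-mirror-≤ (f 2) high-mirror (λ _ → isNonzero≤1 _)
      where
      shifted : ∀ i j → j + i + 2 ≡ f 2 → (f 1 + j) + i + 2 ≡ f 3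
      shifted i j e = trans ([F+a]+b+2≡[a+b+2]+F (f 1) j i) (cong (_+ f 1) e)
      mirrored : ∀ i x → x + i + 2 ≡ f 3 → x + (f 4 + (f 4 + i)) + 2 ≡ f 6
      mirrored i x e = trans (a+[F+b]+2≡[a+b+2]+F (f 4) x (f 4 + i))
                         (cong (_+ f 4) (trans (a+[F+b]+2≡[a+b+2]+F (f 4) x i) (trans (cong (_+ f 4) e) (+-comm (f 3) (f 4)))))
      high-mirror : ∀ i j → j + i + 2 ≡ f 2 → high i ≤ isNonzero (χ (f 1 + j))
      high-mirror i j e = ≤-reflexive (χ⟨⟩-mirror (4 + t) {f 1 + j} (mirrored i (f 1 + j) (shifted i j e))
                                         (≤-trans (a+b+2≡c⇒a<c (shifted i j e)) (≤-trans (f-≤-suc 3) (f-≤-suc 4))))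

    ∑-split-band : ∑ (λ i → u (f 4 + i)) (f 2) ≤ 2 + N (3 + t)
    ∑-split-band = begin
      ∑ (λ i → u (f 4 + i)) (f 2)                        ≤⟨ ∑-mono-≤ (f 2) (λ i i<f2 → split-band i<f2) ⟩
      ∑ (λ r → low r + high r) (f 2)                     ≡⟨ ∑-distrib-+ low high (f 2) ⟩
      ∑ low (f 2) + ∑ high (f 2)                         ≤⟨ +-mono-≤ ∑-low ∑-high ⟩
      (1 + N (1 + t)) + (1 + nonzeros (f 1) (f 2))       ≡⟨ cong suc (+-suc (N (1 + t)) _) ⟩
      2 + (N (1 + t) + nonzeros (f 1) (f 2))             ≡⟨ cong (_+_ 2) (∑-+ (λ i → isNonzero (χ i)) (f 1) (f 2)) ⟨
      2 + ∑ (λ i → isNonzero (χ i)) (f 1 + f 2)          ≡⟨ cong (λ n → 2 + ∑ (λ i → isNonzero (χ i)) n) (+-comm (f 1) (f 2)) ⟩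
      2 + N (3 + t)                                      ∎
      where
      open ≤-Reasoning

    ∑-repeat-band : ∑ (λ s → u (f 4 + (f 2 + s))) (f 1) ≡ B (1 + t)
    ∑-repeat-band = ∑-cong (f 1) (λ s s<f1 → cong isNonzero (repeat-band s<f1))

  B-recurrence : ∀ t → B (5 + t) ≤ N (3 + t) + N (3 + t) + B (1 + t) + 3
  B-recurrence t = begin
    ∑ u (f 4 + f 3)
      ≡⟨ ∑-+ u (f 4) (f 3) ⟩
    ∑ u (f 3 + f 2) + ∑ (λ i → u (f 4 + i)) (f 2 + f 1)
      ≡⟨ cong₂ _+_ (∑-+ u (f 3) (f 2)) (∑-+ (λ i → u (f 4 + i)) (f 2) (f 1)) ⟩
    (∑ u (f 3) + ∑ (λ i → u (f 3 + i)) (f 2)) + (∑ (λ i → u (f 4 + i)) (f 2) + ∑ (λ i → u (f 4 + (f 2 + i))) (f 1))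
      ≤⟨ +-mono-≤ (+-mono-≤ ∑-mirror-band (≤-reflexive ∑-zero-band)) (+-mono-≤ ∑-split-band (≤-reflexive ∑-repeat-band)) ⟩
    (1 + N (3 + t) + 0) + ((2 + N (3 + t)) + B (1 + t))
      ≡⟨ collect (N (3 + t)) (B (1 + t)) ⟩
    N (3 + t) + N (3 + t) + B (1 + t) + 3
      ∎
    where
    open ≤-Reasoning
    open Block t
    collect : ∀ n b → (1 + n + 0) + ((2 + n) + b) ≡ n + n + b + 3
    collect = NS.solve-∀

  -- Growth rates

  N-suc : ∀ j → N (1 + j) ≡ 1 + ∑ B j
  N-suc zero    = refl
  N-suc (suc j) = begin
    N (2 + j)               ≡⟨ ∑-+ (λ i → isNonzero (χ i)) (fib (1 + j)) (fib j) ⟩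
    N (1 + j) + B j         ≡⟨ cong (_+ B j) (N-suc j) ⟩
    1 + (∑ B j + B j)       ≡⟨ cong suc (∑-suc B j) ⟨
    1 + ∑ B (suc j)         ∎
    where open ≡-Reasoning

  B≤fib : ∀ j → B j ≤ fib j
  B≤fib j = ∑-≤-length (fib j) (λ _ → isNonzero≤1 _)

  B-bound-step : ∀ p q b s B₅ → p ≤ q → 5 * p * b ≤ 1000 * (8 * q) → 3 * (5 * (5 * p)) * s ≤ 5000 * (8 * (8 * q)) →
                 B₅ ≤ (1 + s) + (1 + s) + b + 3 → 5 * (5 * (5 * (5 * (5 * p)))) * B₅ ≤ 1000 * (8 * (8 * (8 * (8 * (8 * q)))))
  B-bound-step p q b s B₅ p≤q hb hs hB = *-cancelˡ-≤ 3 (begin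
    3 * (5 * (5 * (5 * (5 * (5 * p)))) * B₅)                      ≤⟨ *-monoʳ-≤ 3 (*-monoʳ-≤ (5 * (5 * (5 * (5 * (5 * p))))) hB) ⟩
    3 * (5 * (5 * (5 * (5 * (5 * p)))) * ((1 + s) + (1 + s) + b + 3)) ≡⟨ expand p s b ⟩
    250 * (3 * (5 * (5 * p)) * s) + 1875 * (5 * p * b) + 46875 * p ≤⟨ +-mono-≤ (+-mono-≤ (*-monoʳ-≤ 250 hs) (*-monoʳ-≤ 1875 hb)) (*-monoʳ-≤ 46875 p≤q) ⟩
    250 * (5000 * (8 * (8 * q))) + 1875 * (1000 * (8 * q)) + 46875 * q ≡⟨ collect q ⟩
    95046875 * q                                                  ≤⟨ *-monoˡ-≤ q (m≤m+n 95046875 3257125) ⟩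
    98304000 * q                                                  ≡⟨ spread q ⟩
    3 * (1000 * (8 * (8 * (8 * (8 * (8 * q))))))                  ∎)
    where
    open ≤-Reasoning
    expand : ∀ p s b → 3 * (5 * (5 * (5 * (5 * (5 * p)))) * ((1 + s) + (1 + s) + b + 3))
                       ≡ 250 * (3 * (5 * (5 * p)) * s) + 1875 * (5 * p * b) + 46875 * p
    expand = NS.solve-∀
    collect : ∀ q → 250 * (5000 * (8 * (8 * q))) + 1875 * (1000 * (8 * q)) + 46875 * q ≡ 95046875 * q
    collect = NS.solve-∀
    spread : ∀ q → 98304000 * q ≡ 3 * (1000 * (8 * (8 * (8 * (8 * (8 * q))))))
    spread = NS.solve-∀

  ∑B-bound-step : ∀ p q s b → p * b ≤ 1000 * q → 3 * p * s ≤ 5000 * q → 3 * (5 * p) * (s + b) ≤ 5000 * (8 * q)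
  ∑B-bound-step p q s b hb hs = begin
    3 * (5 * p) * (s + b)                   ≡⟨ expand p s b ⟩
    5 * (3 * p * s) + 15 * (p * b)          ≤⟨ +-mono-≤ (*-monoʳ-≤ 5 hs) (*-monoʳ-≤ 15 hb) ⟩
    5 * (5000 * q) + 15 * (1000 * q)        ≡⟨ collect q ⟩
    5000 * (8 * q)                          ∎
    where
    open ≤-Reasoning
    expand : ∀ p s b → 3 * (5 * p) * (s + b) ≡ 5 * (3 * p * s) + 15 * (p * b)
    expand = NS.solve-∀
    collect : ∀ q → 5 * (5000 * q) + 15 * (1000 * q) ≡ 5000 * (8 * q)
    collect = NS.solve-∀

  ∑B-bound : ∀ j → 3 * 5 ^ j * ∑ B j ≤ 5000 * 8 ^ j
  ∑B-bound j = proj₂ (<-rec Bounds (λ i rec → B-bound i rec , ∑B-bound′ i rec) j)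
    where
    Bounds : ℕ → Set
    Bounds j = 5 ^ j * B j ≤ 1000 * 8 ^ j × 3 * 5 ^ j * ∑ B j ≤ 5000 * 8 ^ j
    B-bound : ∀ j → (∀ {i} → i < j → Bounds i) → 5 ^ j * B j ≤ 1000 * 8 ^ j
    B-bound j rec with j ≤? 4
    ... | yes j≤4 = subst (5 ^ j * B j ≤_) (*-comm (8 ^ j) 1000)
                      (*-mono-≤ (^-monoˡ-≤ j (m≤m+n 5 3)) (≤-trans (B≤fib j) (≤-trans (fib-mono-≤ j≤4) (m≤m+n 5 995))))
    ... | no j≰4 with m≤n⇒∃[o]m+o≡n (≰⇒> j≰4)
    ...   | t , refl = B-bound-step (5 ^ t) (8 ^ t) (B (1 + t)) (∑ B (2 + t)) (B (5 + t))
                         (^-monoˡ-≤ t (m≤m+n 5 3)) (proj₁ (rec (m≤n+m (2 + t) 3))) (proj₂ (rec (m≤n+m (3 + t) 2)))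
                         (subst (λ n → B (5 + t) ≤ n + n + B (1 + t) + 3) (N-suc (2 + t)) (B-recurrence t))
    ∑B-bound′ : ∀ j → (∀ {i} → i < j → Bounds i) → 3 * 5 ^ j * ∑ B j ≤ 5000 * 8 ^ j
    ∑B-bound′ zero    _   = z≤n
    ∑B-bound′ (suc m) rec = subst (λ z → 3 * 5 ^ suc m * z ≤ 5000 * 8 ^ suc m) (sym (∑-suc B m))
                              (∑B-bound-step (5 ^ m) (8 ^ m) (∑ B m) (B m) (proj₁ (rec (n<1+n m))) (proj₂ (rec (n<1+n m))))

  ^-distribʳ-* : ∀ m n k → (m * n) ^ k ≡ m ^ k * n ^ k
  ^-distribʳ-* m n zero    = refl
  ^-distribʳ-* m n (suc k) = trans (cong (m * n *_) (^-distribʳ-* m n k)) (interchange m n (m ^ k) (n ^ k))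
    where
    interchange : ∀ a b c d → a * b * (c * d) ≡ a * c * (b * d)
    interchange = NS.solve-∀

  bernoulli : ∀ a j → a ^ j * (a + j) ≤ a * suc a ^ j
  bernoulli a zero    = ≤-reflexive (trans (*-identityˡ (a + 0)) (trans (+-identityʳ a) (sym (*-identityʳ a))))
  bernoulli a (suc j) = begin
    a * X * (a + suc j)                ≡⟨ expand a X j ⟩
    a * (X * (a + j)) + a * X          ≤⟨ +-monoʳ-≤ (a * (X * (a + j))) (subst (_≤ X * (a + j)) (*-comm X a) (*-monoʳ-≤ X (m≤m+n a j))) ⟩
    a * (X * (a + j)) + X * (a + j)    ≡⟨ collect a (X * (a + j)) ⟩
    suc a * (X * (a + j))              ≤⟨ *-monoʳ-≤ (suc a) (bernoulli a j) ⟩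
    suc a * (a * suc a ^ j)            ≡⟨ *-comm (suc a) _ ⟩
    a * suc a ^ j * suc a              ≡⟨ *-assoc a (suc a ^ j) (suc a) ⟩
    a * (suc a ^ j * suc a)            ≡⟨ cong (a *_) (*-comm (suc a ^ j) (suc a)) ⟩
    a * suc a ^ suc j                  ∎
    where
    open ≤-Reasoning
    X = a ^ j
    expand : ∀ a X j → a * X * (a + suc j) ≡ a * (X * (a + j)) + a * X
    expand = NS.solve-∀
    collect : ∀ a Y → a * Y + Y ≡ suc a * Y
    collect = NS.solve-∀

  fib-pow-lower : ∀ c d → c * c ≤ d * c + d * d → c ≤ 2 * d → ∀ j → c ^ j ≤ 2 * fib j * d ^ j
  fib-pow-lower c d c²≤dc+d² c≤2d = go
    where
    go : ∀ j → c ^ j ≤ 2 * fib j * d ^ j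
    go zero          = m≤m+n 1 1
    go (suc zero)    = subst₂ _≤_ (sym (*-identityʳ c)) (cong (2 *_) (sym (*-identityʳ d))) c≤2d
    go (suc (suc j)) = begin
      c * (c * x)                                        ≡⟨ *-assoc c c x ⟨
      c * c * x                                          ≤⟨ *-monoˡ-≤ x c²≤dc+d² ⟩
      (d * c + d * d) * x                                ≡⟨ expand c d x ⟩
      d * (c * x) + d * d * x                            ≤⟨ +-mono-≤ (*-monoʳ-≤ d (go (suc j))) (*-monoʳ-≤ (d * d) (go j)) ⟩
      d * (2 * fib (1 + j) * (d * D)) + d * d * (2 * fib j * D) ≡⟨ collect d (fib (1 + j)) (fib j) D ⟩
      2 * (fib (1 + j) + fib j) * (d * (d * D))          ∎
      where
      open ≤-Reasoning
      x = c ^ j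
      D = d ^ j
      expand : ∀ c d x → (d * c + d * d) * x ≡ d * (c * x) + d * d * x
      expand = NS.solve-∀
      collect : ∀ d f₁ f₀ D → d * (2 * f₁ * (d * D)) + d * d * (2 * f₀ * D) ≡ 2 * (f₁ + f₀) * (d * (d * D))
      collect = NS.solve-∀

  -- f_j ≥ (161/100)^j / 2, and Bernoulli's inequality (161/160)^j ≥ 1 + j/160 supplies the linear factor.
  fib-lower : ∀ j → (160 + j) * 8 ^ j ≤ 320 * fib j * 5 ^ j
  fib-lower j = *-cancelʳ-≤ _ _ (20 ^ j) {{m^n≢0 20 j}} (begin
    (160 + j) * 8 ^ j * 20 ^ j         ≡⟨ *-assoc (160 + j) (8 ^ j) (20 ^ j) ⟩
    (160 + j) * (8 ^ j * 20 ^ j)       ≡⟨ cong ((160 + j) *_) (^-distribʳ-* 8 20 j) ⟨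
    (160 + j) * 160 ^ j                ≡⟨ *-comm (160 + j) (160 ^ j) ⟩
    160 ^ j * (160 + j)                ≤⟨ bernoulli 160 j ⟩
    160 * 161 ^ j                      ≤⟨ *-monoʳ-≤ 160 (fib-pow-lower 161 100 (m≤m+n 25921 179) (m≤m+n 161 39) j) ⟩
    160 * (2 * fib j * 100 ^ j)        ≡⟨ cong (λ z → 160 * (2 * fib j * z)) (^-distribʳ-* 5 20 j) ⟩
    160 * (2 * fib j * (5 ^ j * 20 ^ j)) ≡⟨ collect (fib j) (5 ^ j) (20 ^ j) ⟩
    320 * fib j * 5 ^ j * 20 ^ j       ∎)
    where
    open ≤-Reasoning
    collect : ∀ f p q → 160 * (2 * f * (p * q)) ≡ 320 * f * p * q
    collect = NS.solve-∀

  nonzeros-≤-∑B : ∀ j {k} → suc k ≤ fib (2 + j) → nonzeros 1 k ≤ ∑ B (1 + j)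
  nonzeros-≤-∑B j {k} k<f = +-cancelˡ-≤ 1 _ _ (begin
    1 + nonzeros 1 k                       ≤⟨ ∑-mono-≤-length (λ i → isNonzero (χ i)) k<f ⟩
    N (2 + j)                              ≡⟨ N-suc (1 + j) ⟩
    1 + ∑ B (1 + j)                        ∎)
    where open ≤-Reasoning

  nonzeros-density : ∀ j {k} → fib (1 + j) ≤ k → suc k ≤ fib (2 + j) → 3 * (161 + j) * nonzeros 1 k ≤ 1600000 * k
  nonzeros-density j {k} f≤k k<f = *-cancelʳ-≤ _ _ (P * Q) {{m*n≢0 P Q {{m^n≢0 5 (1 + j)}} {{m^n≢0 8 (1 + j)}}}} (begin
    3 * (161 + j) * Z * (P * Q)            ≤⟨ *-monoˡ-≤ (P * Q) (*-monoʳ-≤ (3 * (161 + j)) (nonzeros-≤-∑B j k<f)) ⟩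
    3 * (161 + j) * S * (P * Q)            ≡⟨ regroup (161 + j) S P Q ⟩
    (3 * P * S) * ((161 + j) * Q)          ≤⟨ *-mono-≤ (∑B-bound (1 + j)) (fib-lower (1 + j)) ⟩
    (5000 * Q) * (320 * fib (1 + j) * P)   ≡⟨ collect Q (fib (1 + j)) P ⟩
    1600000 * fib (1 + j) * (P * Q)        ≤⟨ *-monoˡ-≤ (P * Q) (*-monoʳ-≤ 1600000 f≤k) ⟩
    1600000 * k * (P * Q)                  ∎)
    where
    open ≤-Reasoning
    P = 5 ^ (1 + j)
    Q = 8 ^ (1 + j)
    Z = nonzeros 1 k
    S = ∑ B (1 + j)
    regroup : ∀ m S P Q → 3 * m * S * (P * Q) ≡ (3 * P * S) * (m * Q)
    regroup = NS.solve-∀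
    collect : ∀ Q f P → (5000 * Q) * (320 * f * P) ≡ 1600000 * f * (P * Q)
    collect = NS.solve-∀

  fib-bracket : ∀ k → ∃ λ j → fib (1 + j) ≤ suc k × suc (suc k) ≤ fib (2 + j)
  fib-bracket zero = 0 , ≤-refl , ≤-refl
  fib-bracket (suc k) with fib-bracket k
  ... | j , f≤k , k<f with suc (suc (suc k)) ≤? fib (2 + j)
  ...   | yes k+1<f = j , m≤n⇒m≤1+n f≤k , k+1<f
  ...   | no  k+1≮f = suc j , ≤-reflexive (sym k+1≡f) , subst (_< fib (3 + j)) (sym k+1≡f) (fib[1+n]<fib[2+n] (1 + j))
    where
    k+1≡f : suc (suc k) ≡ fib (2 + j)
    k+1≡f = ≤-antisym k<f (≤-pred (≰⇒> k+1≮f))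

  fib-index-≤ : ∀ {i j k} → fib (1 + i) ≤ k → k < fib (2 + j) → i ≤ j
  fib-index-≤ {i} {j} f≤k k<f with i ≤? j
  ... | yes i≤j = i≤j
  ... | no  i≰j = contradiction (<-≤-trans k<f (≤-trans (fib-mono-≤ (s≤s (≰⇒> i≰j))) f≤k)) (n≮n _)

  nonzeros-sparse : ∀ D k → fib (1 + 1600000 * D) ≤ k → nonzeros 1 k * D < k
  nonzeros-sparse D zero    f≤0 = contradiction f≤0 (<⇒≱ (fib-pos (1 + 1600000 * D)))
  nonzeros-sparse D (suc k) f≤k = sparse-within (fib-bracket k)
    where
    sparse-within : ∃ (λ j → fib (1 + j) ≤ suc k × suc (suc k) ≤ fib (2 + j)) → nonzeros 1 (suc k) * D < suc k
    sparse-within (j , f≤k' , k<f) = scaled (nonzeros 1 (suc k)) (nonzeros-density j f≤k' k<f)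
      where
      MD≤j : 1600000 * D ≤ j
      MD≤j = fib-index-≤ f≤k k<f
      scaled : ∀ Z → 3 * (161 + j) * Z ≤ 1600000 * suc k → Z * D < suc k
      scaled zero      _ = s≤s z≤n
      scaled Z@(suc _) h = *-cancelˡ-< 1600000 (Z * D) (suc k) (begin-strict
        1600000 * (Z * D)   ≡⟨ swap 1600000 Z D ⟩
        Z * (1600000 * D)   ≤⟨ *-monoʳ-≤ Z MD≤j ⟩
        Z * j               <⟨ *-monoʳ-< Z (<-≤-trans (m<n+m j {161} (s≤s z≤n)) (m≤n*m (161 + j) 3)) ⟩
        Z * (3 * (161 + j)) ≡⟨ *-comm Z (3 * (161 + j)) ⟩
        3 * (161 + j) * Z   ≤⟨ h ⟩
        1600000 * suc k     ∎)
        where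
        open ≤-Reasoning
        swap : ∀ M Z D → M * (Z * D) ≡ Z * (M * D)
        swap = NS.solve-∀

  #zeros+#nonzeros : ∀ (g : ℕ → ℤ) f n →
    length (filter (λ x → g x ≟ + 0) (applyUpTo f n)) + ∑ (λ i → isNonzero (g (f i))) n ≡ n
  #zeros+#nonzeros g f zero    = refl
  #zeros+#nonzeros g f (suc n) with g (f 0) ≟ + 0
  ... | yes g≡0 = cong suc (trans (cong (λ z → L + (isNonzero z + S)) g≡0) IH)
    where
    L = length (filter (λ x → g x ≟ + 0) (applyUpTo (f ∘ suc) n))
    S = ∑ (λ i → isNonzero (g (f (suc i)))) n
    IH = #zeros+#nonzeros g (f ∘ suc) n
  ... | no  g≢0 = trans (cong (λ z → L + (z + S)) (isNonzero-≢0 g≢0)) (trans (+-suc L S) (cong suc IH))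
    where
    L = length (filter (λ x → g x ≟ + 0) (applyUpTo (f ∘ suc) n))
    S = ∑ (λ i → isNonzero (g (f (suc i)))) n
    IH = #zeros+#nonzeros g (f ∘ suc) n

  E+nonzeros : ∀ k → E k + nonzeros 1 k ≡ k
  E+nonzeros k = suc-injective (trans (sym (+-suc (E k) (nonzeros 1 k))) (#zeros+#nonzeros χ id (suc k)))

open import Data.Nat using (ℕ; zero; suc; _+_; _*_; _≤_; NonZero)
import Data.Nat as ℕ
open import Data.Nat.Properties using (≤-trans; m≤n*m; *-identityʳ; <⇒≱)
open import Data.Nat.Coprimality using (Coprime)
open import Data.Integer using (ℤ; +_; -[1+_]; -1ℤ) renaming (_*_ to _*ℤ_; _+_ to _+ℤ_; -_ to -ℤ_)
import Data.Integer as ℤ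
import Data.Integer.Properties as ℤ
open import Data.Integer.Tactic.RingSolver using (solve-∀)
open import Data.Rational using (ℚ; mkℚ; _/_; _-_; -_; ∣_∣; 1ℚ; 0ℚ; _<_; toℚᵘ; *<*)
import Data.Rational.Properties as ℚ
open import Data.Rational.Unnormalised using (mkℚᵘ; *≡*) renaming (_+_ to _+ᵘ_; -_ to -ᵘ_; *<* to *<*ᵘ)
import Data.Rational.Unnormalised.Properties as ℚᵘ
open import Data.Product using (∃-syntax; _,_)
open import Function using (_∘_)
open import Relation.Binary.PropositionalEquality
open import Relation.Nullary using (contradiction)
open Sparsity using (fib-pos; nonzeros; E+nonzeros; nonzeros-sparse)

a/n-1≡-b/n : ∀ a b n → a + b ≡ suc n → (+ a) / suc n - 1ℚ ≡ - ((+ b) / suc n)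
a/n-1≡-b/n a b n a+b≡n = ℚ.toℚᵘ-injective (begin
  toℚᵘ ((+ a) / suc n - 1ℚ)                 ≈⟨ ℚ.toℚᵘ-homo-+ ((+ a) / suc n) (- 1ℚ) ⟩
  toℚᵘ ((+ a) / suc n) +ᵘ toℚᵘ (- 1ℚ)       ≈⟨ ℚᵘ.+-cong (ℚ.toℚᵘ-fromℚᵘ (mkℚᵘ (+ a) n)) (ℚᵘ.≃-refl {mkℚᵘ -1ℤ 0}) ⟩
  mkℚᵘ (+ a) n +ᵘ mkℚᵘ -1ℤ 0           ≈⟨ *≡* cross-multiplied ⟩
  -ᵘ mkℚᵘ (+ b) n                           ≈⟨ ℚᵘ.-‿cong (ℚᵘ.≃-sym (ℚ.toℚᵘ-fromℚᵘ (mkℚᵘ (+ b) n))) ⟩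
  -ᵘ toℚᵘ ((+ b) / suc n)                   ≈⟨ ℚᵘ.≃-sym (ℚ.toℚᵘ-homo‿- ((+ b) / suc n)) ⟩
  toℚᵘ (- ((+ b) / suc n))                  ∎)
  where
  open ℚᵘ.≃-Reasoning
  +n≡a+b : + suc n ≡ + a +ℤ + b
  +n≡a+b = trans (cong +_ (sym a+b≡n)) (ℤ.pos-+ a b)
  identity : ∀ a b → (a *ℤ + 1 +ℤ -1ℤ *ℤ (a +ℤ b)) *ℤ (a +ℤ b) ≡ -ℤ b *ℤ (a +ℤ b)
  identity = solve-∀
  cross-multiplied : (+ a *ℤ + 1 +ℤ -1ℤ *ℤ + suc n) *ℤ + suc n ≡ -ℤ (+ b) *ℤ + suc (n * 1)
  cross-multiplied = trans (cong (λ m → (+ a *ℤ + 1 +ℤ -1ℤ *ℤ m) *ℤ m) +n≡a+b)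
    (trans (identity (+ a) (+ b)) (cong (-ℤ (+ b) *ℤ_) (trans (sym +n≡a+b) (cong (+_ ∘ suc) (sym (*-identityʳ n))))))

∣a/n-1∣≡b/n : ∀ a b n → a + b ≡ suc n → ∣ (+ a) / suc n - 1ℚ ∣ ≡ (+ b) / suc n
∣a/n-1∣≡b/n a b n a+b≡n = begin
  ∣ (+ a) / suc n - 1ℚ ∣        ≡⟨ cong ∣_∣ (a/n-1≡-b/n a b n a+b≡n) ⟩
  ∣ - ((+ b) / suc n) ∣         ≡⟨ ℚ.∣-p∣≡∣p∣ ((+ b) / suc n) ⟩
  ∣ (+ b) / suc n ∣             ≡⟨ ℚ.0≤p⇒∣p∣≡p (ℚ.nonNegative⁻¹ _ {{ℚ.normalize-nonNeg b (suc n)}}) ⟩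
  (+ b) / suc n                 ∎
  where open ≡-Reasoning

b/n<ε : ∀ b n p d .(c : Coprime (suc p) (suc d)) → b * suc d ℕ.< suc n → (+ b) / suc n < mkℚ (+ suc p) d c
b/n<ε b n p d c b*d<n = ℚ.toℚᵘ-cancel-< (ℚᵘ.<-respˡ-≃ (ℚᵘ.≃-sym (ℚ.toℚᵘ-fromℚᵘ (mkℚᵘ (+ b) n))) (*<*ᵘ cross-multiplied))
  where
  cross-multiplied : + b *ℤ + suc d ℤ.< + suc p *ℤ + suc n
  cross-multiplied = subst₂ ℤ._<_ (ℤ.pos-* b (suc d)) (ℤ.pos-* (suc p) (suc n))
                       (ℤ.+<+ (≤-trans b*d<n (m≤n*m (suc n) (suc p))))

theorem5p3 : (ε : ℚ) → 0ℚ < ε →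
    ∃[ K ] ((k : ℕ) → .{{_ : NonZero k}} → K ≤ k → ∣ ((+ E k) / k) - 1ℚ ∣ < ε)
theorem5p3 ε@(mkℚ (+ suc p) d c) _ = K , bound
  where
  K = fib (1 + 1600000 * suc d)
  bound : (k : ℕ) → .{{_ : NonZero k}} → K ≤ k → ∣ ((+ E k) / k) - 1ℚ ∣ < ε
  bound zero    K≤0 = contradiction K≤0 (<⇒≱ (fib-pos (1 + 1600000 * suc d)))
  bound (suc k) K≤k = subst (_< ε) (sym (∣a/n-1∣≡b/n (E (suc k)) Z k (E+nonzeros (suc k))))
                        (b/n<ε Z k p d c (nonzeros-sparse (suc d) (suc k) K≤k))
    where
    Z = nonzeros 1 (suc k)
theorem5p3 (mkℚ (+ zero)  _ _) (*<* (ℤ.+<+ ()))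
theorem5p3 (mkℚ -[1+ _ ]  _ _) (*<* ())
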